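{- The function $L:\mathbb{Z}_{\ge0}^2\to\mathbb{Z}$ given by $L(n,k)=3^{n-3k}\binom{n}{3k}\frac{(3k)!}{k!^3}$ (which is $0$ when $3k>n$) has the double Lucas property.
   Context: A function $L:\mathbb{Z}_{\ge0}^2\to\mathbb{Z}$ has the double Lucas property if $L(n,k)=0$ whenever $k>n$, and for every prime $p$ and all $n,k\ge0$, writing $n=\sum_{i=0}^r n_ip^i$, $k=\sum_{i=0}^r k_ip^i$ with base-$p$ digits $0\le n_i,k_i<p$ (padded with zeros to a common length), $L(n,k)\equiv\prod_{i=0}^r L(n_i,k_i)\pmod p$. -}

module Defs where

open import Data.Nat as ℕ using (ℕ; zero; suc; _∸_; _^_; _<_; _!; NonZero)
open import Data.Nat.Properties using (_!≢0; m^n≢0; m*n≢0)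
open import Data.Nat.Combinatorics using (_C_)
open import Data.Nat.Primality using (Prime; prime⇒nonZero)
open import Data.Integer as ℤ using (ℤ; +_)
open import Data.Integer.Divisibility using (_∣_)
open import Data.List using (List; foldr; map; upTo)
open import Data.Product using (_×_)
open import Relation.Binary.PropositionalEquality using (_≡_)

digit : (p : ℕ) → .{{NonZero p}} → ℕ → ℕ → ℕ
digit p i n = (n ℕ./ (p ^ i)) {{m^n≢0 p i}} ℕ.% p

prodℤ : List ℤ → ℤ
prodℤ = foldr ℤ._*_ (+ 1)

_≡_[mod_] : ℤ → ℤ → ℕ → Set
a ≡ b [mod m ] = (+ m) ∣ (a ℤ.- b)

DoubleLucas : (ℕ → ℕ → ℤ) → Set
DoubleLucas L =
  (∀ n k → n < k → L n k ≡ + 0)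
  × (∀ p (pr : Prime p) (r n k : ℕ) → n < p ^ suc r → k < p ^ suc r →
      L n k ≡ prodℤ (map (λ i → L (digit p {{prime⇒nonZero pr}} i n)
                                  (digit p {{prime⇒nonZero pr}} i k))
                         (upTo (suc r))) [mod p ])

-- (3k)! / (k!)^3  (an exact division)
multi3 : ℕ → ℕ
multi3 k = ((3 ℕ.* k) !) ℕ./ (k ! ℕ.* k ! ℕ.* k !)
  where instance _ = m*n≢0 (k ! ℕ.* k !) (k !) {{m*n≢0 (k !) (k !) {{k !≢0}} {{k !≢0}}}} {{k !≢0}}

-- L(n,k) = 3^(n-3k) * C(n,3k) * (3k)!/(k!)^3   (truncated subtraction; the
-- binomial vanishes when 3k > n, so L(n,k) = 0 then)
L3 : ℕ → ℕ → ℤ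
L3 n k = + (3 ^ (n ∸ 3 ℕ.* k) ℕ.* (n C (3 ℕ.* k)) ℕ.* multi3 k)

{-# OPTIONS --safe #-}
module Submission where

-- Write L(n,k) = 3^(n−3k) C(n,3k) · C(3k,k) C(2k,k) and split off the lowest base-p digits,
-- n = n₀ + p N and k = k₀ + p K.  By Lucas' theorem and Fermat's little theorem
-- (3^(p e) ≡ 3^e), the factor a^(n−m) C(n,m) is multiplicative in the digits.  If 3k₀ < p then
-- 3k, 2k have lowest digits 3k₀, 2k₀, all three factors split, and L(n,k) ≡ L(n₀,k₀) L(N,K).
-- If 3k₀ ≥ p then L(n₀,k₀) = 0 as n₀ < p ≤ 3k₀, while adding k to 2k (or k to k) carries in the
-- lowest digit, so C(3k,k) (or C(2k,k)) ≡ 0 by Lucas.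

open import Defs

open import Data.Fin.Base using (Fin; zero; suc; toℕ; inject₁; fromℕ)
open import Data.Fin.Properties using (toℕ<n; toℕ-inject₁; toℕ-fromℕ)
import Data.Integer.Base as ℤ
open import Data.Integer.Divisibility.Signed using (divides; ∣⇒∣ᵤ)
import Data.Integer.Properties as ℤP
import Data.Integer.Tactic.RingSolver as ℤSolver
open import Data.List.Base using ([]; _∷_; map; upTo; applyUpTo)
open import Data.List.Properties using (map-upTo; map-applyUpTo)
open import Data.Nat as ℕ
  using (ℕ; zero; suc; _+_; _*_; _∸_; _^_; _<_; _≤_; _>_; _!; NonZero; s≤s; z<s; s<s)
open import Data.Nat.Combinatorics
open import Data.Nat.Divisibility using (_∣_; m∣m*n; ∣m⇒∣m*n; >⇒∤; n∣m⇒m%n≡0)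
open import Data.Nat.DivMod
open import Data.Nat.ListAction using (product)
open import Data.Nat.Primality using (Prime; prime⇒nonZero; prime⇒nonTrivial; euclidsLemma)
open import Data.Nat.Properties
open import Algebra.Properties.Monoid.Sum +-0-monoid using (sum; sum-init-last)
import Algebra.Properties.Semiring.Binomial +-*-semiring as Binomial
import Algebra.Properties.Semiring.Exp +-*-semiring as Exp
import Algebra.Properties.Semiring.Mult +-*-semiring as Mult
open import Data.Nat.Tactic.RingSolver using (solve-∀)
open import Data.Product.Base using (_,_)
open import Data.Sum.Base using (inj₁; inj₂)
open import Function.Base using (_∘_)
open import Level using (0ℓ)
open import Relation.Binary.Bundles using (Setoid)
import Relation.Binary.Construct.On as On
open import Relation.Binary.Definitions using (tri<; tri≈; tri>)
open import Relation.Binary.PropositionalEquality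
import Relation.Binary.Reasoning.Setoid as SetoidReasoning
open import Relation.Nullary.Decidable.Core using (yes; no)
open import Relation.Nullary.Negation using (¬_; contradiction)

nCk*[k!*[n∸k]!]≡n! : ∀ {n k} → k ≤ n → (n C k) * (k ! * (n ∸ k) !) ≡ n !
nCk*[k!*[n∸k]!]≡n! {n} {k} k≤n =
  trans (cong (_* (k ! * (n ∸ k) !)) (nCk≡n!/k![n-k]! k≤n)) (m/n*n≡m (k![n∸k]!∣n! k≤n))
  where instance _ = k !* (n ∸ k) !≢0

[k+m]Ck*[k!*m!]≡[k+m]! : ∀ k m → ((k + m) C k) * (k ! * m !) ≡ (k + m) !
[k+m]Ck*[k!*m!]≡[k+m]! k m =
  trans (cong (λ j → ((k + m) C k) * (k ! * j !)) (sym (m+n∸m≡n k m))) (nCk*[k!*[n∸k]!]≡n! (m≤m+n k m))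

multi3≡[3k]Ck*[2k]Ck : ∀ k → multi3 k ≡ ((3 * k) C k) * ((2 * k) C k)
multi3≡[3k]Ck*[2k]Ck k = begin
  (3 * k) ! / (k ! * k ! * k !)                                          ≡⟨ /-congˡ [3k]!≡ ⟩
  ((3 * k) C k) * ((2 * k) C k) * (k ! * k ! * k !) / (k ! * k ! * k !)  ≡⟨ m*n/n≡m _ _ ⟩
  ((3 * k) C k) * ((2 * k) C k)                                          ∎
  where
  open ≡-Reasoning
  instance _ = m*n≢0 (k ! * k !) (k !) {{k !* k !≢0}} {{k !≢0}}
  rearrange : ∀ a b c → a * (c * (b * (c * c))) ≡ a * b * (c * c * c)
  rearrange = solve-∀
  [3k]!≡ : (3 * k) ! ≡ ((3 * k) C k) * ((2 * k) C k) * (k ! * k ! * k !)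
  [3k]!≡ = begin
    (3 * k) !                                                   ≡⟨ [k+m]Ck*[k!*m!]≡[k+m]! k (2 * k) ⟨
    ((3 * k) C k) * (k ! * (2 * k) !)                           ≡⟨ cong (λ j → ((3 * k) C k) * (k ! * j)) ([k+m]Ck*[k!*m!]≡[k+m]! k (1 * k)) ⟨
    ((3 * k) C k) * (k ! * (((2 * k) C k) * (k ! * (1 * k) !))) ≡⟨ cong (λ j → ((3 * k) C k) * (k ! * (((2 * k) C k) * (k ! * j !)))) (*-identityˡ k) ⟩
    ((3 * k) C k) * (k ! * (((2 * k) C k) * (k ! * k !)))       ≡⟨ rearrange ((3 * k) C k) ((2 * k) C k) (k !) ⟩
    ((3 * k) C k) * ((2 * k) C k) * (k ! * k ! * k !)           ∎

n∣n! : ∀ n .{{_ : NonZero n}} → n ∣ n !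
n∣n! (suc n) = m∣m*n (n !)

0^n≡0 : ∀ n .{{_ : NonZero n}} → 0 ^ n ≡ 0
0^n≡0 (suc n) = refl

×≡* : ∀ n x → n Mult.× x ≡ n * x
×≡* zero    x = refl
×≡* (suc n) x = cong (x +_) (×≡* n x)

Exp^≡^ : ∀ x n → x Exp.^ n ≡ x ^ n
Exp^≡^ x zero    = refl
Exp^≡^ x (suc n) = cong (x *_) (Exp^≡^ x n)

[a+pb]∸[c+pd]≡[a∸c]+p[b∸d] : ∀ {a b c d} p → c ≤ a → d ≤ b → (a + p * b) ∸ (c + p * d) ≡ (a ∸ c) + p * (b ∸ d)
[a+pb]∸[c+pd]≡[a∸c]+p[b∸d] {a} {b} {c} {d} p c≤a d≤b = begin
  (a + p * b) ∸ (c + p * d)                              ≡⟨ cong₂ (λ x y → (x + p * y) ∸ (c + p * d)) (m∸n+n≡m c≤a) (m∸n+n≡m d≤b) ⟨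
  ((a ∸ c) + c + p * ((b ∸ d) + d)) ∸ (c + p * d)        ≡⟨ cong (_∸ (c + p * d)) (regroup (a ∸ c) c p (b ∸ d) d) ⟩
  ((a ∸ c) + p * (b ∸ d)) + (c + p * d) ∸ (c + p * d)    ≡⟨ m+n∸n≡m _ (c + p * d) ⟩
  (a ∸ c) + p * (b ∸ d)                                  ∎
  where
  open ≡-Reasoning
  regroup : ∀ x c p y d → x + c + p * (y + d) ≡ (x + p * y) + (c + p * d)
  regroup = solve-∀

-- n C (m − q) with genuine subtraction: 0 when m < q, where n C (m ∸ q) would be n C 0 = 1.
infixl 6.5 _C[_-_]
_C[_-_] : ℕ → ℕ → ℕ → ℕ
n C[ m     - zero  ] = n C m
n C[ zero  - suc q ] = 0
n C[ suc m - suc q ] = n C[ m - q ]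

C[-]-≤ : ∀ n {m q} → q ≤ m → n C[ m - q ] ≡ n C (m ∸ q)
C[-]-≤ n {m}     {zero}  _         = refl
C[-]-≤ n {suc m} {suc q} (s≤s q≤m) = C[-]-≤ n q≤m

C[-]-< : ∀ n {m q} → m < q → n C[ m - q ] ≡ 0
C[-]-< n {zero}  {suc q} _         = refl
C[-]-< n {suc m} {suc q} (s<s m<q) = C[-]-< n m<q

C[0-q]-indep : ∀ n n′ q → n C[ 0 - q ] ≡ n′ C[ 0 - q ]
C[0-q]-indep n n′ zero    = refl
C[0-q]-indep n n′ (suc q) = refl

C[-]-pascal : ∀ n m q → n C[ m - q ] + n C[ suc m - q ] ≡ suc n C[ suc m - q ]
C[-]-pascal n m       zero    = nCk+nC[k+1]≡[n+1]C[k+1] n m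
C[-]-pascal n zero    (suc q) = C[0-q]-indep n (suc n) q
C[-]-pascal n (suc m) (suc q) = C[-]-pascal n m q

-- The coefficient of x^m in (x + a)^n.
weightedC : ℕ → ℕ → ℕ → ℕ
weightedC a n m = a ^ (n ∸ m) * (n C m)

L3ℕ : ℕ → ℕ → ℕ
L3ℕ n k = weightedC 3 n (3 * k) * (((3 * k) C k) * ((2 * k) C k))

L3≡+L3ℕ : ∀ n k → L3 n k ≡ ℤ.+ L3ℕ n k
L3≡+L3ℕ n k = cong (λ c → ℤ.+ (weightedC 3 n (3 * k) * c)) (multi3≡[3k]Ck*[2k]Ck k)

L3ℕ≡0 : ∀ n k → n < 3 * k → L3ℕ n k ≡ 0
L3ℕ≡0 n k n<3k = begin
  3 ^ (n ∸ 3 * k) * (n C (3 * k)) * multi  ≡⟨ cong (λ c → 3 ^ (n ∸ 3 * k) * c * multi) (k>n⇒nCk≡0 n<3k) ⟩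
  3 ^ (n ∸ 3 * k) * 0 * multi              ≡⟨ cong (_* multi) (*-zeroʳ (3 ^ (n ∸ 3 * k))) ⟩
  0                                        ∎
  where
  open ≡-Reasoning
  multi = ((3 * k) C k) * ((2 * k) C k)

L3-vanishes : ∀ n k → n < k → L3 n k ≡ ℤ.+ 0
L3-vanishes n k n<k = trans (L3≡+L3ℕ n k) (cong ℤ.+_ (L3ℕ≡0 n k (<-≤-trans n<k (m≤m+n k (2 * k)))))

digit-zero : ∀ p .{{_ : NonZero p}} n → digit p 0 n ≡ n % p
digit-zero p n = cong (_% p) (n/1≡n n)

digit-suc : ∀ p .{{_ : NonZero p}} i n → digit p (suc i) n ≡ digit p i (n / p)
digit-suc p i n = cong (_% p) (sym (m/n/o≡m/[n*o] n p (p ^ i) {{_}} {{m^n≢0 p i}} {{m^n≢0 p (suc i)}}))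

applyUpTo-cong : ∀ {A : Set} {f g : ℕ → A} n → (∀ i → f i ≡ g i) → applyUpTo f n ≡ applyUpTo g n
applyUpTo-cong zero    f≗g = refl
applyUpTo-cong (suc n) f≗g = cong₂ _∷_ (f≗g 0) (applyUpTo-cong n (f≗g ∘ suc))

prodℤ-map-+ : ∀ xs → prodℤ (map ℤ.+_ xs) ≡ ℤ.+ product xs
prodℤ-map-+ []       = refl
prodℤ-map-+ (x ∷ xs) = trans (cong (ℤ.+ x ℤ.*_) (prodℤ-map-+ xs)) (sym (ℤP.pos-* x (product xs)))

prodℤ-L3-upTo : ∀ {f g : ℕ → ℕ} m →
                prodℤ (map (λ i → L3 (f i) (g i)) (upTo m)) ≡ ℤ.+ product (applyUpTo (λ i → L3ℕ (f i) (g i)) m)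
prodℤ-L3-upTo {f} {g} m = begin
  prodℤ (map (λ i → L3 (f i) (g i)) (upTo m))             ≡⟨ cong prodℤ (map-upTo (λ i → L3 (f i) (g i)) m) ⟩
  prodℤ (applyUpTo (λ i → L3 (f i) (g i)) m)              ≡⟨ cong prodℤ (applyUpTo-cong m (λ i → L3≡+L3ℕ (f i) (g i))) ⟩
  prodℤ (applyUpTo (λ i → ℤ.+ L3ℕ (f i) (g i)) m)         ≡⟨ cong prodℤ (map-applyUpTo (λ i → L3ℕ (f i) (g i)) ℤ.+_ m) ⟨
  prodℤ (map ℤ.+_ (applyUpTo (λ i → L3ℕ (f i) (g i)) m))  ≡⟨ prodℤ-map-+ (applyUpTo (λ i → L3ℕ (f i) (g i)) m) ⟩
  ℤ.+ product (applyUpTo (λ i → L3ℕ (f i) (g i)) m)       ∎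
  where open ≡-Reasoning

module Modulo (p : ℕ) .{{p≢0 : NonZero p}} where

  infix 4 _≈_
  _≈_ : ℕ → ℕ → Set
  a ≈ b = a % p ≡ b % p

  ≈-setoid : Setoid 0ℓ 0ℓ
  ≈-setoid = On.setoid (setoid ℕ) (_% p)

  module ≈-Reasoning = SetoidReasoning ≈-setoid

  ≡⇒≈ : ∀ {a b} → a ≡ b → a ≈ b
  ≡⇒≈ = cong (_% p)

  +-cong : ∀ {a b c d} → a ≈ b → c ≈ d → a + c ≈ b + d
  +-cong {a} {b} {c} {d} a≈b c≈d = begin
    (a + c) % p              ≡⟨ %-distribˡ-+ a c p ⟩
    (a % p + c % p) % p      ≡⟨ cong₂ (λ x y → (x + y) % p) a≈b c≈d ⟩
    (b % p + d % p) % p      ≡⟨ %-distribˡ-+ b d p ⟨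
    (b + d) % p              ∎
    where open ≡-Reasoning

  *-cong : ∀ {a b c d} → a ≈ b → c ≈ d → a * c ≈ b * d
  *-cong {a} {b} {c} {d} a≈b c≈d = begin
    (a * c) % p              ≡⟨ %-distribˡ-* a c p ⟩
    (a % p * (c % p)) % p    ≡⟨ cong₂ (λ x y → (x * y) % p) a≈b c≈d ⟩
    (b % p * (d % p)) % p    ≡⟨ %-distribˡ-* b d p ⟨
    (b * d) % p              ∎
    where open ≡-Reasoning

  ∣⇒≈0 : ∀ {a} → p ∣ a → a ≈ 0
  ∣⇒≈0 {a} p∣a = trans (n∣m⇒m%n≡0 a p p∣a) (sym (m*n%n≡0 0 p))

  ≈⇒≡[mod] : ∀ {a b} → a ≈ b → (ℤ.+ a) ≡ (ℤ.+ b) [mod p ]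
  ≈⇒≡[mod] {a} {b} a≈b = ∣⇒∣ᵤ (divides (ℤ.+ (a / p) ℤ.- ℤ.+ (b / p)) (begin
    ℤ.+ a ℤ.- ℤ.+ b                                                                    ≡⟨ cong₂ ℤ._-_ (expand a) expand-b ⟩
    (ℤ.+ (a % p) ℤ.+ ℤ.+ (a / p) ℤ.* ℤ.+ p) ℤ.- (ℤ.+ (a % p) ℤ.+ ℤ.+ (b / p) ℤ.* ℤ.+ p)  ≡⟨ cancel (ℤ.+ (a % p)) (ℤ.+ (a / p)) (ℤ.+ (b / p)) (ℤ.+ p) ⟩
    (ℤ.+ (a / p) ℤ.- ℤ.+ (b / p)) ℤ.* ℤ.+ p                                              ∎))
    where
    open ≡-Reasoning
    expand : ∀ m → ℤ.+ m ≡ ℤ.+ (m % p) ℤ.+ ℤ.+ (m / p) ℤ.* ℤ.+ p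
    expand m = trans (cong ℤ.+_ (m≡m%n+[m/n]*n m p))
                     (trans (ℤP.pos-+ (m % p) (m / p * p)) (cong (ℤ._+_ (ℤ.+ (m % p))) (ℤP.pos-* (m / p) p)))
    expand-b : ℤ.+ b ≡ ℤ.+ (a % p) ℤ.+ ℤ.+ (b / p) ℤ.* ℤ.+ p
    expand-b = trans (expand b) (cong (λ r → ℤ.+ r ℤ.+ ℤ.+ (b / p) ℤ.* ℤ.+ p) (sym a≈b))
    cancel : ∀ r x y q → (r ℤ.+ x ℤ.* q) ℤ.- (r ℤ.+ y ℤ.* q) ≡ (x ℤ.- y) ℤ.* q
    cancel = ℤSolver.solve-∀

  sum-≈0 : ∀ {n} (f : Fin n → ℕ) → (∀ i → f i ≈ 0) → sum f ≈ 0
  sum-≈0 {zero}  f f≈0 = refl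
  sum-≈0 {suc n} f f≈0 = +-cong (f≈0 zero) (sum-≈0 (f ∘ suc) (f≈0 ∘ suc))

  sum-≈-ends : ∀ {n} .{{_ : NonZero n}} (f : Fin (suc n) → ℕ) →
               (∀ i → 0 < toℕ i → toℕ i < n → f i ≈ 0) → sum f ≈ f zero + f (fromℕ n)
  sum-≈-ends {suc n} f middle≈0 = begin
    f zero + sum (f ∘ suc)                                   ≡⟨ cong (f zero +_) (sum-init-last (f ∘ suc)) ⟩
    f zero + (sum (f ∘ suc ∘ inject₁) + f (fromℕ (suc n)))   ≈⟨ +-cong {f zero} refl (+-cong (sum-≈0 _ inner≈0) refl) ⟩
    f zero + f (fromℕ (suc n))                               ∎
    where
    open ≈-Reasoning
    inner≈0 : ∀ i → f (suc (inject₁ i)) ≈ 0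
    inner≈0 i = middle≈0 (suc (inject₁ i)) z<s (s<s (subst (_< n) (sym (toℕ-inject₁ i)) (toℕ<n i)))

module _ (p : ℕ) (p-prime : Prime p) where

  private instance
    p≢0 : NonZero p
    p≢0 = prime⇒nonZero p-prime

  open Modulo p

  m+p*0≡m : ∀ m → m + p * 0 ≡ m
  m+p*0≡m m = trans (cong (m +_) (*-zeroʳ p)) (+-identityʳ m)

  m+p*[1+n]≡m+p*n+p : ∀ m n → m + p * suc n ≡ m + p * n + p
  m+p*[1+n]≡m+p*n+p m n = trans (cong (m +_) (*-suc p n)) (swap m p (p * n))
    where
    swap : ∀ a b c → a + (b + c) ≡ a + c + b
    swap = solve-∀

  p>0 : p > 0
  p>0 = ℕ.>-nonZero⁻¹ p

  p∤m! : ∀ {m} → m < p → ¬ p ∣ m !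
  p∤m! {zero}  m<p p∣1 = >⇒∤ (ℕ.nonTrivial⇒n>1 p {{prime⇒nonTrivial p-prime}}) p∣1
  p∤m! {suc m} m<p p∣m! with euclidsLemma (suc m) (m !) p-prime p∣m!
  ... | inj₁ p∣1+m = >⇒∤ m<p p∣1+m
  ... | inj₂ p∣m!  = p∤m! (<-trans (n<1+n m) m<p) p∣m!

  p∣pCk : ∀ {k} → 0 < k → k < p → p ∣ p C k
  p∣pCk {k} 0<k k<p
    with euclidsLemma (p C k) (k ! * (p ∸ k) !) p-prime
           (subst (p ∣_) (sym (nCk*[k!*[n∸k]!]≡n! (<⇒≤ k<p))) (n∣n! p))
  ... | inj₁ p∣pCk = p∣pCk
  ... | inj₂ p∣k!*[p∸k]! with euclidsLemma (k !) ((p ∸ k) !) p-prime p∣k!*[p∸k]!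
  ...   | inj₁ p∣k!     = contradiction p∣k! (p∤m! k<p)
  ...   | inj₂ p∣[p∸k]! = contradiction p∣[p∸k]! (p∤m! (∸-monoʳ-< 0<k (<⇒≤ k<p)))

  [1+x]^p≈1+x^p : ∀ x → (1 + x) ^ p ≈ 1 + x ^ p
  [1+x]^p≈1+x^p x = begin
    (1 + x) ^ p                               ≡⟨ Exp^≡^ (1 + x) p ⟨
    (1 + x) Exp.^ p                           ≡⟨ Binomial.theorem 1 x (*-comm 1 x) p ⟩
    sum (binomialTerm p)                      ≈⟨ sum-≈-ends (binomialTerm p) middle≈0 ⟩
    binomialTerm p zero + binomialTerm p (fromℕ p)  ≈⟨ +-cong first last ⟩
    x ^ p + 1                                 ≡⟨ +-comm (x ^ p) 1 ⟩
    1 + x ^ p                                 ∎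
    where
    open ≈-Reasoning
    open Binomial 1 x using (binomial; binomialTerm)
    middle≈0 : ∀ i → 0 < toℕ i → toℕ i < p → binomialTerm p i ≈ 0
    middle≈0 i 0<i i<p = ∣⇒≈0 (subst (p ∣_) (sym (×≡* (p C toℕ i) (binomial p i))) (∣m⇒∣m*n _ (p∣pCk 0<i i<p)))
    first : binomialTerm p zero ≈ x ^ p
    first = begin
      1 Mult.× (1 * x Exp.^ p)  ≡⟨ ×≡* 1 (1 * x Exp.^ p) ⟩
      1 * (1 * x Exp.^ p)       ≡⟨ trans (*-identityˡ _) (*-identityˡ _) ⟩
      x Exp.^ p                 ≡⟨ Exp^≡^ x p ⟩
      x ^ p                     ∎
    last : binomialTerm p (fromℕ p) ≈ 1
    last = begin
      binomialTerm p (fromℕ p)                    ≡⟨ cong (λ j → (p C j) Mult.× (1 Exp.^ j * x Exp.^ (p ∸ j))) (toℕ-fromℕ p) ⟩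
      (p C p) Mult.× (1 Exp.^ p * x Exp.^ (p ∸ p))  ≡⟨ ×≡* (p C p) _ ⟩
      (p C p) * (1 Exp.^ p * x Exp.^ (p ∸ p))       ≡⟨ cong₂ (λ c j → c * (1 Exp.^ p * x Exp.^ j)) (nCn≡1 p) (n∸n≡0 p) ⟩
      1 * (1 Exp.^ p * 1)                         ≡⟨ trans (*-identityˡ _) (*-identityʳ _) ⟩
      1 Exp.^ p                                   ≡⟨ Exp^≡^ 1 p ⟩
      1 ^ p                                       ≡⟨ ^-zeroˡ p ⟩
      1                                           ∎

  x^p≈x : ∀ x → x ^ p ≈ x
  x^p≈x zero    = ≡⇒≈ (0^n≡0 p)
  x^p≈x (suc x) = begin
    (1 + x) ^ p  ≈⟨ [1+x]^p≈1+x^p x ⟩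
    1 + x ^ p    ≈⟨ +-cong {1} refl (x^p≈x x) ⟩
    1 + x        ∎
    where open ≈-Reasoning

  -- Vandermonde: (n + p) C m = Σⱼ (p C j) (n C (m − j)), where p C j ≡ 0 unless j ∈ {0, p}.
  [n+p]Cm≈nCm+nC[m-p] : ∀ n m → (n + p) C m ≈ n C m + n C[ m - p ]
  [n+p]Cm≈nCm+nC[m-p] zero zero = ≡⇒≈ (cong suc (sym (C[-]-< 0 p>0)))
  [n+p]Cm≈nCm+nC[m-p] zero (suc m) with <-cmp (suc m) p
  ... | tri< m<p _ _ = begin
    p C suc m       ≈⟨ ∣⇒≈0 (p∣pCk z<s m<p) ⟩
    0               ≡⟨ C[-]-< 0 m<p ⟨
    0 C[ suc m - p ] ∎
    where open ≈-Reasoning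
  ... | tri≈ _ m≡p _ = ≡⇒≈ (begin
    p C suc m        ≡⟨ cong (p C_) m≡p ⟩
    p C p            ≡⟨ nCn≡1 p ⟩
    1                ≡⟨ cong (0 C_) (n∸n≡0 p) ⟨
    0 C (p ∸ p)      ≡⟨ cong (λ j → 0 C (j ∸ p)) m≡p ⟨
    0 C (suc m ∸ p)  ≡⟨ C[-]-≤ 0 (≤-reflexive (sym m≡p)) ⟨
    0 C[ suc m - p ] ∎)
    where open ≡-Reasoning
  ... | tri> _ _ m>p = ≡⇒≈ (begin
    p C suc m        ≡⟨ k>n⇒nCk≡0 m>p ⟩
    0                ≡⟨ k>n⇒nCk≡0 (m<n⇒0<n∸m m>p) ⟨
    0 C (suc m ∸ p)  ≡⟨ C[-]-≤ 0 (<⇒≤ m>p) ⟨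
    0 C[ suc m - p ] ∎)
    where open ≡-Reasoning
  [n+p]Cm≈nCm+nC[m-p] (suc n) zero = ≡⇒≈ (cong suc (sym (C[-]-< (suc n) p>0)))
  [n+p]Cm≈nCm+nC[m-p] (suc n) (suc m) = begin
    suc (n + p) C suc m                                          ≡⟨ nCk+nC[k+1]≡[n+1]C[k+1] (n + p) m ⟨
    (n + p) C m + (n + p) C suc m                                ≈⟨ +-cong ([n+p]Cm≈nCm+nC[m-p] n m) ([n+p]Cm≈nCm+nC[m-p] n (suc m)) ⟩
    (n C m + n C[ m - p ]) + (n C suc m + n C[ suc m - p ])      ≡⟨ +-exchange (n C m) _ _ _ ⟩
    (n C m + n C suc m) + (n C[ m - p ] + n C[ suc m - p ])      ≡⟨ cong₂ _+_ (nCk+nC[k+1]≡[n+1]C[k+1] n m) (C[-]-pascal n m p) ⟩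
    suc n C suc m + suc n C[ suc m - p ]                          ∎
    where
    open ≈-Reasoning
    +-exchange : ∀ a b c d → (a + b) + (c + d) ≡ (a + c) + (b + d)
    +-exchange = solve-∀

  lucas : ∀ {n₀ m₀} N M → n₀ < p → m₀ < p → (n₀ + p * N) C (m₀ + p * M) ≈ (n₀ C m₀) * (N C M)
  lucas {n₀} {m₀} zero zero _ _ = ≡⇒≈ (begin
    (n₀ + p * 0) C (m₀ + p * 0)  ≡⟨ cong₂ _C_ (m+p*0≡m n₀) (m+p*0≡m m₀) ⟩
    n₀ C m₀                      ≡⟨ *-identityʳ (n₀ C m₀) ⟨
    (n₀ C m₀) * 1                ∎)
    where open ≡-Reasoning
  lucas {n₀} {m₀} zero (suc M) n₀<p _ =
    ≡⇒≈ (trans (k>n⇒nCk≡0 n₀+p*0<m₀+p*[1+M]) (sym (*-zeroʳ (n₀ C m₀))))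
    where
    n₀+p*0<m₀+p*[1+M] : n₀ + p * 0 < m₀ + p * suc M
    n₀+p*0<m₀+p*[1+M] = begin-strict
      n₀ + p * 0       ≡⟨ m+p*0≡m n₀ ⟩
      n₀               <⟨ n₀<p ⟩
      p                ≤⟨ m≤m*n p (suc M) ⟩
      p * suc M        ≤⟨ m≤n+m (p * suc M) m₀ ⟩
      m₀ + p * suc M   ∎
      where open ≤-Reasoning
  lucas {n₀} {m₀} (suc N) zero n₀<p m₀<p = begin
    (n₀ + p * suc N) C (m₀ + p * 0)                                   ≡⟨ cong (_C (m₀ + p * 0)) (m+p*[1+n]≡m+p*n+p n₀ N) ⟩
    (n₀ + p * N + p) C (m₀ + p * 0)                                   ≈⟨ [n+p]Cm≈nCm+nC[m-p] (n₀ + p * N) (m₀ + p * 0) ⟩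
    (n₀ + p * N) C (m₀ + p * 0) + (n₀ + p * N) C[ m₀ + p * 0 - p ]    ≈⟨ +-cong (lucas N zero n₀<p m₀<p) (≡⇒≈ (C[-]-< _ m₀+p*0<p)) ⟩
    (n₀ C m₀) * 1 + 0                                                  ≡⟨ +-identityʳ _ ⟩
    (n₀ C m₀) * 1                                                      ∎
    where
    open ≈-Reasoning
    m₀+p*0<p : m₀ + p * 0 < p
    m₀+p*0<p = subst (_< p) (sym (m+p*0≡m m₀)) m₀<p
  lucas {n₀} {m₀} (suc N) (suc M) n₀<p m₀<p = begin
    (n₀ + p * suc N) C (m₀ + p * suc M)                                   ≡⟨ cong (_C (m₀ + p * suc M)) (m+p*[1+n]≡m+p*n+p n₀ N) ⟩
    (n₀ + p * N + p) C (m₀ + p * suc M)                                   ≈⟨ [n+p]Cm≈nCm+nC[m-p] (n₀ + p * N) (m₀ + p * suc M) ⟩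
    (n₀ + p * N) C (m₀ + p * suc M) + (n₀ + p * N) C[ m₀ + p * suc M - p ] ≈⟨ +-cong {(n₀ + p * N) C (m₀ + p * suc M)} refl carry ⟩
    (n₀ + p * N) C (m₀ + p * suc M) + (n₀ + p * N) C (m₀ + p * M)         ≈⟨ +-cong (lucas N (suc M) n₀<p m₀<p) (lucas N M n₀<p m₀<p) ⟩
    (n₀ C m₀) * (N C suc M) + (n₀ C m₀) * (N C M)                          ≡⟨ *-distribˡ-+ (n₀ C m₀) (N C suc M) (N C M) ⟨
    (n₀ C m₀) * (N C suc M + N C M)                                        ≡⟨ cong ((n₀ C m₀) *_) (+-comm (N C suc M) (N C M)) ⟩
    (n₀ C m₀) * (N C M + N C suc M)                                        ≡⟨ cong ((n₀ C m₀) *_) (nCk+nC[k+1]≡[n+1]C[k+1] N M) ⟩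
    (n₀ C m₀) * (suc N C suc M)                                            ∎
    where
    open ≈-Reasoning
    carry : (n₀ + p * N) C[ m₀ + p * suc M - p ] ≈ (n₀ + p * N) C (m₀ + p * M)
    carry = begin
      (n₀ + p * N) C[ m₀ + p * suc M - p ]  ≡⟨ C[-]-≤ (n₀ + p * N) (subst (p ≤_) (sym (m+p*[1+n]≡m+p*n+p m₀ M)) (m≤n+m p _)) ⟩
      (n₀ + p * N) C (m₀ + p * suc M ∸ p)   ≡⟨ cong (λ j → (n₀ + p * N) C (j ∸ p)) (m+p*[1+n]≡m+p*n+p m₀ M) ⟩
      (n₀ + p * N) C (m₀ + p * M + p ∸ p)   ≡⟨ cong ((n₀ + p * N) C_) (m+n∸n≡m (m₀ + p * M) p) ⟩
      (n₀ + p * N) C (m₀ + p * M)           ∎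

  weightedC-lucas : ∀ a {n₀ m₀} N M → n₀ < p → m₀ < p →
                    weightedC a (n₀ + p * N) (m₀ + p * M) ≈ weightedC a n₀ m₀ * weightedC a N M
  weightedC-lucas a {n₀} {m₀} N M n₀<p m₀<p = begin
    a ^ ((n₀ + p * N) ∸ (m₀ + p * M)) * ((n₀ + p * N) C (m₀ + p * M))  ≈⟨ *-cong {a ^ ((n₀ + p * N) ∸ (m₀ + p * M))} refl (lucas N M n₀<p m₀<p) ⟩
    a ^ ((n₀ + p * N) ∸ (m₀ + p * M)) * ((n₀ C m₀) * (N C M))          ≈⟨ regroup ⟩
    a ^ (n₀ ∸ m₀) * (n₀ C m₀) * (a ^ (N ∸ M) * (N C M))                ∎
    where
    open ≈-Reasoning
    regroup : a ^ ((n₀ + p * N) ∸ (m₀ + p * M)) * ((n₀ C m₀) * (N C M)) ≈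
              a ^ (n₀ ∸ m₀) * (n₀ C m₀) * (a ^ (N ∸ M) * (N C M))
    regroup with m₀ ≤? n₀ | M ≤? N
    ... | yes m₀≤n₀ | yes M≤N = begin
      a ^ ((n₀ + p * N) ∸ (m₀ + p * M)) * ((n₀ C m₀) * (N C M))  ≈⟨ *-cong a^-split refl ⟩
      a ^ (n₀ ∸ m₀) * a ^ (N ∸ M) * ((n₀ C m₀) * (N C M))        ≡⟨ interchange (a ^ (n₀ ∸ m₀)) (a ^ (N ∸ M)) (n₀ C m₀) (N C M) ⟩
      a ^ (n₀ ∸ m₀) * (n₀ C m₀) * (a ^ (N ∸ M) * (N C M))        ∎
      where
      interchange : ∀ x y u v → x * y * (u * v) ≡ x * u * (y * v)
      interchange = solve-∀
      a^-split : a ^ ((n₀ + p * N) ∸ (m₀ + p * M)) ≈ a ^ (n₀ ∸ m₀) * a ^ (N ∸ M)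
      a^-split = begin
        a ^ ((n₀ + p * N) ∸ (m₀ + p * M))      ≡⟨ cong (a ^_) ([a+pb]∸[c+pd]≡[a∸c]+p[b∸d] p m₀≤n₀ M≤N) ⟩
        a ^ ((n₀ ∸ m₀) + p * (N ∸ M))          ≡⟨ ^-distribˡ-+-* a (n₀ ∸ m₀) (p * (N ∸ M)) ⟩
        a ^ (n₀ ∸ m₀) * a ^ (p * (N ∸ M))      ≡⟨ cong (λ e → a ^ (n₀ ∸ m₀) * a ^ e) (*-comm p (N ∸ M)) ⟩
        a ^ (n₀ ∸ m₀) * a ^ ((N ∸ M) * p)      ≡⟨ cong (a ^ (n₀ ∸ m₀) *_) (^-*-assoc a (N ∸ M) p) ⟨
        a ^ (n₀ ∸ m₀) * (a ^ (N ∸ M)) ^ p      ≈⟨ *-cong {a ^ (n₀ ∸ m₀)} refl (x^p≈x (a ^ (N ∸ M))) ⟩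
        a ^ (n₀ ∸ m₀) * a ^ (N ∸ M)            ∎
    ... | no m₀≰n₀ | _ rewrite k>n⇒nCk≡0 (≰⇒> m₀≰n₀) =
      ≡⇒≈ (both-zero (a ^ ((n₀ + p * N) ∸ (m₀ + p * M))) (N C M) (a ^ (n₀ ∸ m₀)) (a ^ (N ∸ M) * (N C M)))
      where
      both-zero : ∀ x c y z → x * (0 * c) ≡ y * 0 * z
      both-zero = solve-∀
    ... | yes _ | no M≰N rewrite k>n⇒nCk≡0 (≰⇒> M≰N) =
      ≡⇒≈ (both-zero (a ^ ((n₀ + p * N) ∸ (m₀ + p * M))) (n₀ C m₀) (a ^ (n₀ ∸ m₀)) (a ^ (N ∸ M)))
      where
      both-zero : ∀ x c y z → x * (c * 0) ≡ y * c * (z * 0)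
      both-zero = solve-∀

  -- Adding the two numbers carries out of the lowest digit, which leaves that digit below k₀.
  C-carry≈0 : ∀ {m₀ k₀} M K → m₀ < p → k₀ < p → p ≤ m₀ + k₀ →
              ((m₀ + p * M) + (k₀ + p * K)) C (k₀ + p * K) ≈ 0
  C-carry≈0 {m₀} {k₀} M K m₀<p k₀<p p≤m₀+k₀ = begin
    ((m₀ + p * M) + (k₀ + p * K)) C (k₀ + p * K)   ≡⟨ cong (_C (k₀ + p * K)) sum≡ ⟩
    (d + p * suc (M + K)) C (k₀ + p * K)           ≈⟨ lucas (suc (M + K)) K (<-trans d<k₀ k₀<p) k₀<p ⟩
    (d C k₀) * (suc (M + K) C K)                   ≡⟨ cong (_* (suc (M + K) C K)) (k>n⇒nCk≡0 d<k₀) ⟩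
    0                                              ∎
    where
    open ≈-Reasoning
    d = m₀ + k₀ ∸ p
    d+p≡m₀+k₀ : d + p ≡ m₀ + k₀
    d+p≡m₀+k₀ = m∸n+n≡m p≤m₀+k₀
    d<k₀ : d < k₀
    d<k₀ = +-cancelʳ-< p d k₀ (subst (_< k₀ + p) (sym d+p≡m₀+k₀) (subst (m₀ + k₀ <_) (+-comm p k₀) (+-monoˡ-< k₀ m₀<p)))
    collect : ∀ m k p M K → (m + p * M) + (k + p * K) ≡ (m + k) + p * (M + K)
    collect = solve-∀
    absorb : ∀ d p x → d + p + p * x ≡ d + p * (1 + x)
    absorb = solve-∀
    sum≡ : (m₀ + p * M) + (k₀ + p * K) ≡ d + p * suc (M + K)
    sum≡ = trans (collect m₀ k₀ p M K) (trans (cong (_+ p * (M + K)) (sym d+p≡m₀+k₀)) (absorb d p (M + K)))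

  [3k]Ck*[2k]Ck≈0 : ∀ {k₀} K → k₀ < p → p ≤ 3 * k₀ →
                    ((3 * (k₀ + p * K)) C (k₀ + p * K)) * ((2 * (k₀ + p * K)) C (k₀ + p * K)) ≈ 0
  [3k]Ck*[2k]Ck≈0 {k₀} K k₀<p p≤3k₀ with 2 * k₀ <? p
  ... | yes 2k₀<p = begin
    ((3 * k) C k) * ((2 * k) C k)                         ≡⟨ cong (λ t → (t C k) * ((2 * k) C k)) (3k≡2k+k k₀ p K) ⟩
    (((2 * k₀ + p * (2 * K)) + k) C k) * ((2 * k) C k)    ≈⟨ *-cong carry refl ⟩
    0 * ((2 * k) C k)                                     ≡⟨⟩
    0                                                     ∎
    where
    open ≈-Reasoning
    k = k₀ + p * K
    3k≡2k+k : ∀ k₀ p K → 3 * (k₀ + p * K) ≡ (2 * k₀ + p * (2 * K)) + (k₀ + p * K)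
    3k≡2k+k = solve-∀
    carry = C-carry≈0 (2 * K) K 2k₀<p k₀<p (subst (p ≤_) (+-comm k₀ (2 * k₀)) p≤3k₀)
  ... | no 2k₀≮p = begin
    ((3 * k) C k) * ((2 * k) C k)                         ≡⟨ cong (λ t → ((3 * k) C k) * (t C k)) (2k≡k+k k₀ p K) ⟩
    ((3 * k) C k) * ((k + k) C k)                         ≈⟨ *-cong {(3 * k) C k} refl carry ⟩
    ((3 * k) C k) * 0                                     ≡⟨ *-zeroʳ ((3 * k) C k) ⟩
    0                                                     ∎
    where
    open ≈-Reasoning
    k = k₀ + p * K
    2k≡k+k : ∀ k₀ p K → 2 * (k₀ + p * K) ≡ (k₀ + p * K) + (k₀ + p * K)
    2k≡k+k = solve-∀
    carry = C-carry≈0 K K k₀<p k₀<p (subst (p ≤_) (cong (k₀ +_) (+-identityʳ k₀)) (≮⇒≥ 2k₀≮p))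

  L3ℕ-lucas : ∀ {n₀ k₀} N K → n₀ < p → k₀ < p → L3ℕ (n₀ + p * N) (k₀ + p * K) ≈ L3ℕ n₀ k₀ * L3ℕ N K
  L3ℕ-lucas {n₀} {k₀} N K n₀<p k₀<p with 3 * k₀ <? p
  ... | yes 3k₀<p = begin
    weightedC 3 n (3 * k) * (((3 * k) C k) * ((2 * k) C k))
      ≡⟨ cong₂ (λ t d → weightedC 3 n t * ((t C k) * (d C k))) (3k≡ k₀ p K) (2k≡ k₀ p K) ⟩
    weightedC 3 n (3 * k₀ + p * (3 * K)) * (((3 * k₀ + p * (3 * K)) C k) * ((2 * k₀ + p * (2 * K)) C k))
      ≈⟨ *-cong (weightedC-lucas 3 N (3 * K) n₀<p 3k₀<p)
                (*-cong (lucas (3 * K) K 3k₀<p k₀<p) (lucas (2 * K) K 2k₀<p k₀<p)) ⟩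
    weightedC 3 n₀ (3 * k₀) * weightedC 3 N (3 * K) * ((((3 * k₀) C k₀) * ((3 * K) C K)) * (((2 * k₀) C k₀) * ((2 * K) C K)))
      ≡⟨ interchange (weightedC 3 n₀ (3 * k₀)) (weightedC 3 N (3 * K)) ((3 * k₀) C k₀) ((3 * K) C K) ((2 * k₀) C k₀) ((2 * K) C K) ⟩
    L3ℕ n₀ k₀ * L3ℕ N K
      ∎
    where
    open ≈-Reasoning
    n = n₀ + p * N
    k = k₀ + p * K
    2k₀<p : 2 * k₀ < p
    2k₀<p = ≤-<-trans (*-monoˡ-≤ k₀ (n≤1+n 2)) 3k₀<p
    3k≡ : ∀ k₀ p K → 3 * (k₀ + p * K) ≡ 3 * k₀ + p * (3 * K)
    3k≡ = solve-∀
    2k≡ : ∀ k₀ p K → 2 * (k₀ + p * K) ≡ 2 * k₀ + p * (2 * K)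
    2k≡ = solve-∀
    interchange : ∀ w₀ w₁ a₀ a₁ b₀ b₁ → w₀ * w₁ * ((a₀ * a₁) * (b₀ * b₁)) ≡ w₀ * (a₀ * b₀) * (w₁ * (a₁ * b₁))
    interchange = solve-∀
  ... | no 3k₀≮p = begin
    weightedC 3 n (3 * k) * (((3 * k) C k) * ((2 * k) C k))  ≈⟨ *-cong {weightedC 3 n (3 * k)} refl ([3k]Ck*[2k]Ck≈0 K k₀<p p≤3k₀) ⟩
    weightedC 3 n (3 * k) * 0                                ≡⟨ *-zeroʳ (weightedC 3 n (3 * k)) ⟩
    0                                                        ≡⟨ L3ℕ[n₀,k₀]≡0 ⟨
    L3ℕ n₀ k₀ * L3ℕ N K                                       ∎
    where
    open ≈-Reasoning
    n = n₀ + p * N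
    k = k₀ + p * K
    p≤3k₀ : p ≤ 3 * k₀
    p≤3k₀ = ≮⇒≥ 3k₀≮p
    L3ℕ[n₀,k₀]≡0 : L3ℕ n₀ k₀ * L3ℕ N K ≡ 0
    L3ℕ[n₀,k₀]≡0 = cong (_* L3ℕ N K) (L3ℕ≡0 n₀ k₀ (<-≤-trans n₀<p p≤3k₀))

  L3ℕ-split : ∀ n k → L3ℕ n k ≈ L3ℕ (n % p) (k % p) * L3ℕ (n / p) (k / p)
  L3ℕ-split n k = begin
    L3ℕ n k                                            ≡⟨ cong₂ L3ℕ (expand n) (expand k) ⟩
    L3ℕ (n % p + p * (n / p)) (k % p + p * (k / p))    ≈⟨ L3ℕ-lucas (n / p) (k / p) (m%n<n n p) (m%n<n k p) ⟩
    L3ℕ (n % p) (k % p) * L3ℕ (n / p) (k / p)          ∎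
    where
    open ≈-Reasoning
    expand : ∀ m → m ≡ m % p + p * (m / p)
    expand m = trans (m≡m%n+[m/n]*n m p) (cong (m % p +_) (*-comm (m / p) p))

  L3ℕ-at-digit : ℕ → ℕ → ℕ → ℕ
  L3ℕ-at-digit n k i = L3ℕ (digit p i n) (digit p i k)

  L3ℕ-digits : ∀ r {n k} → n < p ^ suc r → k < p ^ suc r →
               L3ℕ n k ≈ product (applyUpTo (L3ℕ-at-digit n k) (suc r))
  L3ℕ-digits zero {n} {k} n<p k<p = begin
    L3ℕ n k                                    ≈⟨ L3ℕ-split n k ⟩
    L3ℕ (n % p) (k % p) * L3ℕ (n / p) (k / p)  ≡⟨ cong₂ (λ x y → L3ℕ (n % p) (k % p) * L3ℕ x y) (m<n⇒m/n≡0 (<-p*1 n<p)) (m<n⇒m/n≡0 (<-p*1 k<p)) ⟩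
    L3ℕ (n % p) (k % p) * 1                    ≡⟨ cong₂ (λ x y → L3ℕ x y * 1) (digit-zero p n) (digit-zero p k) ⟨
    L3ℕ-at-digit n k 0 * 1                     ∎
    where
    open ≈-Reasoning
    <-p*1 : ∀ {m} → m < p * 1 → m < p
    <-p*1 = subst (_ <_) (*-identityʳ p)
  L3ℕ-digits (suc r) {n} {k} n< k< = begin
    L3ℕ n k                                                       ≈⟨ L3ℕ-split n k ⟩
    L3ℕ (n % p) (k % p) * L3ℕ (n / p) (k / p)                     ≈⟨ *-cong {L3ℕ (n % p) (k % p)} refl (L3ℕ-digits r (shift-digits n<) (shift-digits k<)) ⟩
    L3ℕ (n % p) (k % p) * product (applyUpTo (L3ℕ-at-digit (n / p) (k / p)) (suc r))
        ≡⟨ cong₂ (λ x y → L3ℕ x y * product (applyUpTo (L3ℕ-at-digit (n / p) (k / p)) (suc r))) (digit-zero p n) (digit-zero p k) ⟨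
    L3ℕ-at-digit n k 0 * product (applyUpTo (L3ℕ-at-digit (n / p) (k / p)) (suc r))
        ≡⟨ cong (λ xs → L3ℕ-at-digit n k 0 * product xs) (applyUpTo-cong (suc r) higher-digit) ⟨
    L3ℕ-at-digit n k 0 * product (applyUpTo (L3ℕ-at-digit n k ∘ suc) (suc r)) ∎
    where
    open ≈-Reasoning
    shift-digits : ∀ {m} → m < p ^ suc (suc r) → m / p < p ^ suc r
    shift-digits {m} m< = m<n*o⇒m/o<n (subst (m <_) (*-comm p (p ^ suc r)) m<)
    higher-digit : ∀ i → L3ℕ-at-digit n k (suc i) ≡ L3ℕ-at-digit (n / p) (k / p) i
    higher-digit i = cong₂ L3ℕ (digit-suc p i n) (digit-suc p i k)

  L3-digits : ∀ r n k → n < p ^ suc r → k < p ^ suc r →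
              L3 n k ≡ prodℤ (map (λ i → L3 (digit p i n) (digit p i k)) (upTo (suc r))) [mod p ]
  L3-digits r n k n< k< =
    subst₂ (λ x y → x ≡ y [mod p ]) (sym (L3≡+L3ℕ n k)) (sym (prodℤ-L3-upTo {λ i → digit p i n} {λ i → digit p i k} (suc r)))
           (≈⇒≡[mod] (L3ℕ-digits r n< k<))

lemma3p6 : DoubleLucas L3
lemma3p6 = L3-vanishes , L3-digits
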